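{- Let $M$ be a $p\times q$ integer matrix whose first row has greatest common divisor $1$. Suppose that applying to $M$ a finite sequence of transformations $\rho_1,\rho_2,\dots,\rho_t$, each of which is of the form $\gamma_{s,m}$ (with $m$ a nonzero integer) or $\epsilon_{s,l,h}$ (with $h$ an integer, $l\ne s$), yields a matrix of the block form $$\begin{pmatrix} 1 & 0\\ \alpha & A\end{pmatrix},$$ where the first row is $(1,0,\dots,0)$, $\alpha$ is a column vector of length $p-1$ and $A$ is a $(p-1)\times(q-1)$ matrix. Then $A$ is an integer matrix.
   Context: For a matrix $M$: $\gamma_{s,m}(M)$ is the matrix obtained from $M$ by multiplying its first row by $m$ and multiplying its $s$-th column by $\frac1m$. $\epsilon_{s,l,h}(M)$ is the matrix obtained from $M$ by adding $h$ times its $s$-th column to its $l$-th column. -}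

module Defs where

open import Data.Nat using (ℕ; zero; suc)
open import Data.Nat.GCD using (gcd)
open import Data.Integer using (ℤ; ∣_∣; 0ℤ)
open import Data.Rational using (ℚ; _/_; _*_; _+_; 1/_; 1ℚ)
open import Data.Fin using (Fin; zero; suc; _≟_)
open import Data.List using (List; foldl)
open import Relation.Binary.PropositionalEquality using (_≡_; _≢_)
open import Relation.Nullary using (yes; no)

Matrix : ℕ → ℕ → Set
Matrix p q = Fin p → Fin q → ℚ

ℤ→ℚ : ℤ → ℚ
ℤ→ℚ z = z / 1

toℚ : ∀ {p q} → (Fin p → Fin q → ℤ) → Matrix p q
toℚ M i j = ℤ→ℚ (M i j)

gcdRow : ∀ {n} → (Fin n → ℤ) → ℕ
gcdRow {zero}  r = 0
gcdRow {suc n} r = gcd ∣ r zero ∣ (gcdRow (λ j → r (suc j)))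

data Transformation (q : ℕ) : Set where
  -- γ_{s,m}: multiply first row by m, multiply s-th column by 1/m (m ≠ 0)
  γ : (s : Fin q) (m : ℤ) → m ≢ 0ℤ → Transformation q
  -- ε_{s,l,h}: add h times column s to column l (l ≠ s)
  ε : (s l : Fin q) (h : ℤ) → l ≢ s → Transformation q


inv : (m : ℤ) → m ≢ 0ℤ → ℚ
inv (ℤ.pos zero) m≢0 = 1ℚ  -- impossible case, value irrelevant
inv (ℤ.pos (suc n)) _ = ℤ.pos 1 / suc n
inv (ℤ.negsuc n) _ = ℤ.negsuc 0 / suc n

apply : ∀ {p q} → Transformation q → Matrix (suc p) q → Matrix (suc p) q
apply (γ s m _) M zero j with j ≟ s
... | yes _ = M zero j
... | no  _ = ℤ→ℚ m * M zero j
apply (γ s m m≢0) M (suc i) j with j ≟ s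
... | yes _ = inv m m≢0 * M (suc i) j
... | no  _ = M (suc i) j
apply (ε s l h _) M i j with j ≟ l
... | yes _ = M i l + ℤ→ℚ h * M i s
... | no  _ = M i j

-- apply ρ₁, then ρ₂, …, then ρ_t (list given in order ρ₁ ∷ … ∷ ρ_t)
applyAll : ∀ {p q} → List (Transformation q) → Matrix (suc p) q → Matrix (suc p) q
applyAll ρs M = foldl (λ N ρ → apply ρ N) M ρs

-- Call a rational matrix integral modulo its first row a if a is integral and every other
-- row is an integral row plus a rational multiple r·a of a; integer matrices qualify with
-- r = 0. An ε keeps this with the same r. A γ_{s,m} divides column s of the lower rows by m,
-- which is harmless as soon as a_s Y + m W = 1 for integers Y, W: then r' = (r + z Y)/m with
-- z = X_s - r a_s works. Such Y, W exist because the first row stays unimodular (a · y = 1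
-- for some integral y) along the whole sequence: this holds at the end, where the first row
-- is (1,0,…,0), and pulls back through every transformation via its integral dual action on
-- y. At the end the first row vanishes off column 0, so there the lower rows are integral.
module Submission where

open import Defs
open import Data.Nat using (ℕ; zero; suc)
open import Data.Integer as ℤ using (ℤ; 0ℤ)
import Data.Integer.Properties as ℤ
open import Data.Rational using (ℚ; 0ℚ; 1ℚ; _+_; _*_; -_; _-_; 1/_)
open import Data.Rational.Properties
  using (↥p/↧p≡p; toℚᵘ-injective; toℚᵘ-homo-+; toℚᵘ-homo-*; toℚᵘ-homo‿-; +-identityˡ; +-identityʳ;
         *-identityˡ; *-identityʳ; *-zeroʳ; *-inverseˡ; +-*-commutativeRing)
open import Data.Rational.Literals using (fromℤ)
import Data.Rational.Unnormalised.Base as ℚᵘ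
import Data.Rational.Unnormalised.Properties as ℚᵘ
open import Data.Rational.Solver using (module +-*-Solver)
open import Algebra.Bundles using (CommutativeRing)
open import Algebra.Properties.Semiring.Sum (CommutativeRing.semiring +-*-commutativeRing)
  using (sum; sum-cong-≗; sum-replicate-zero; ∑-distrib-+; *-distribˡ-sum)
open import Data.Fin using (Fin; zero; suc; _≟_)
open import Data.Vec.Functional using (Vector)
open import Data.List using (List; []; _∷_)
open import Data.Product using (∃; ∃₂; _,_; _×_; proj₁; proj₂)
open import Data.Empty using (⊥-elim)
open import Relation.Nullary using (yes; no)
open import Relation.Binary.PropositionalEquality
  using (_≡_; _≢_; refl; sym; trans; cong; cong₂; subst; module ≡-Reasoning)

open +-*-Solver

ℤ→ℚ≡fromℤ : ∀ z → ℤ→ℚ z ≡ fromℤ z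
ℤ→ℚ≡fromℤ z = ↥p/↧p≡p (fromℤ z)

ℤ→ℚ-homo-+ : ∀ a b → ℤ→ℚ (a ℤ.+ b) ≡ ℤ→ℚ a + ℤ→ℚ b
ℤ→ℚ-homo-+ a b = begin
  ℤ→ℚ (a ℤ.+ b)      ≡⟨ ℤ→ℚ≡fromℤ (a ℤ.+ b) ⟩
  fromℤ (a ℤ.+ b)    ≡⟨ toℚᵘ-injective (ℚᵘ.≃-trans (ℚᵘ.*≡* numerators)
                          (ℚᵘ.≃-sym (toℚᵘ-homo-+ (fromℤ a) (fromℤ b)))) ⟩
  fromℤ a + fromℤ b  ≡⟨ sym (cong₂ _+_ (ℤ→ℚ≡fromℤ a) (ℤ→ℚ≡fromℤ b)) ⟩
  ℤ→ℚ a + ℤ→ℚ b      ∎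
  where
  open ≡-Reasoning
  numerators : (a ℤ.+ b) ℤ.* ℤ.+ 1 ≡ (a ℤ.* ℤ.+ 1 ℤ.+ b ℤ.* ℤ.+ 1) ℤ.* ℤ.+ 1
  numerators = cong (ℤ._* ℤ.+ 1) (sym (cong₂ ℤ._+_ (ℤ.*-identityʳ a) (ℤ.*-identityʳ b)))

ℤ→ℚ-homo-* : ∀ a b → ℤ→ℚ (a ℤ.* b) ≡ ℤ→ℚ a * ℤ→ℚ b
ℤ→ℚ-homo-* a b = begin
  ℤ→ℚ (a ℤ.* b)      ≡⟨ ℤ→ℚ≡fromℤ (a ℤ.* b) ⟩
  fromℤ (a ℤ.* b)    ≡⟨ toℚᵘ-injective (ℚᵘ.≃-sym (toℚᵘ-homo-* (fromℤ a) (fromℤ b))) ⟩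
  fromℤ a * fromℤ b  ≡⟨ sym (cong₂ _*_ (ℤ→ℚ≡fromℤ a) (ℤ→ℚ≡fromℤ b)) ⟩
  ℤ→ℚ a * ℤ→ℚ b      ∎
  where open ≡-Reasoning

ℤ→ℚ-homo‿- : ∀ a → ℤ→ℚ (ℤ.- a) ≡ - ℤ→ℚ a
ℤ→ℚ-homo‿- a = begin
  ℤ→ℚ (ℤ.- a)    ≡⟨ ℤ→ℚ≡fromℤ (ℤ.- a) ⟩
  fromℤ (ℤ.- a)  ≡⟨ toℚᵘ-injective (ℚᵘ.≃-sym (toℚᵘ-homo‿- (fromℤ a))) ⟩
  - fromℤ a      ≡⟨ sym (cong -_ (ℤ→ℚ≡fromℤ a)) ⟩
  - ℤ→ℚ a        ∎
  where open ≡-Reasoning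

inv-inverseˡ : ∀ m (m≢0 : m ≢ 0ℤ) → inv m m≢0 * ℤ→ℚ m ≡ 1ℚ
inv-inverseˡ (ℤ.+ zero)  m≢0 = ⊥-elim (m≢0 refl)
inv-inverseˡ m@(ℤ.+ suc n) m≢0 =
  trans (cong₂ _*_ (↥p/↧p≡p (1/ fromℤ m)) (ℤ→ℚ≡fromℤ m)) (*-inverseˡ (fromℤ m))
inv-inverseˡ m@(ℤ.-[1+ n ]) m≢0 =
  trans (cong₂ _*_ (↥p/↧p≡p (1/ fromℤ m)) (ℤ→ℚ≡fromℤ m)) (*-inverseˡ (fromℤ m))

IsIntegral : ℚ → Set
IsIntegral x = ∃ λ z → x ≡ ℤ→ℚ z

isIntegral-+ : ∀ {x y} → IsIntegral x → IsIntegral y → IsIntegral (x + y)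
isIntegral-+ (a , refl) (b , refl) = a ℤ.+ b , sym (ℤ→ℚ-homo-+ a b)

isIntegral-* : ∀ {x y} → IsIntegral x → IsIntegral y → IsIntegral (x * y)
isIntegral-* (a , refl) (b , refl) = a ℤ.* b , sym (ℤ→ℚ-homo-* a b)

isIntegral-difference : ∀ {x y} → IsIntegral x → IsIntegral y → IsIntegral (x - y)
isIntegral-difference x∈ℤ (b , refl) = isIntegral-+ x∈ℤ (ℤ.- b , sym (ℤ→ℚ-homo‿- b))

isIntegral-sum : ∀ {n} {f : Vector ℚ n} → (∀ j → IsIntegral (f j)) → IsIntegral (sum f)
isIntegral-sum {zero}  f∈ℤ = 0ℤ , refl
isIntegral-sum {suc n} f∈ℤ = isIntegral-+ (f∈ℤ zero) (isIntegral-sum (λ j → f∈ℤ (suc j)))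

δ : ∀ {n} → Fin n → ℚ → Vector ℚ n
δ zero    c zero    = c
δ zero    c (suc j) = 0ℚ
δ (suc k) c zero    = 0ℚ
δ (suc k) c (suc j) = δ k c j

δ-diag : ∀ {n} (k : Fin n) c → δ k c k ≡ c
δ-diag zero    c = refl
δ-diag (suc k) c = δ-diag k c

δ-offDiag : ∀ {n} (k j : Fin n) c → j ≢ k → δ k c j ≡ 0ℚ
δ-offDiag zero    zero    c j≢k = ⊥-elim (j≢k refl)
δ-offDiag zero    (suc j) c j≢k = refl
δ-offDiag (suc k) zero    c j≢k = refl
δ-offDiag (suc k) (suc j) c j≢k = δ-offDiag k j c (λ j≡k → j≢k (cong suc j≡k))

sum-δ : ∀ {n} (k : Fin n) c → sum (δ k c) ≡ c
sum-δ {suc n} zero    c = trans (cong (c +_) (sum-replicate-zero n)) (+-identityʳ c)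
sum-δ {suc n} (suc k) c = trans (+-identityˡ (sum (δ k c))) (sum-δ k c)

sum-+-δ : ∀ {n} (f : Vector ℚ n) k c → sum (λ j → f j + δ k c j) ≡ sum f + c
sum-+-δ f k c = trans (∑-distrib-+ f (δ k c)) (cong (sum f +_) (sum-δ k c))

infix 7 _·_
_·_ : ∀ {n} → Vector ℚ n → Vector ℤ n → ℚ
a · y = sum (λ j → a j * ℤ→ℚ (y j))

Unimodular : ∀ {n} → Vector ℚ n → Set
Unimodular a = ∃ λ y → a · y ≡ 1ℚ

firstUnit-unimodular : ∀ {n} (a : Vector ℚ (suc n)) → a zero ≡ 1ℚ → (∀ j → a (suc j) ≡ 0ℚ) →
                       Unimodular a
firstUnit-unimodular {n} a a₀≡1 a₊≡0 = e₀ , cong₂ _+_ (trans (*-identityʳ (a zero)) a₀≡1) rest≡0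
  where
  e₀ : Vector ℤ (suc n)
  e₀ zero    = ℤ.+ 1
  e₀ (suc _) = 0ℤ
  rest≡0 : sum (λ j → a (suc j) * 0ℚ) ≡ 0ℚ
  rest≡0 = trans (sum-cong-≗ (λ j → *-zeroʳ (a (suc j)))) (sum-replicate-zero n)

γ-dual : ∀ {n} → Fin n → ℤ → Vector ℤ n → Vector ℤ n
γ-dual s m y j with j ≟ s
... | yes _ = y j
... | no  _ = m ℤ.* y j

ε-dual : ∀ {n} → Fin n → Fin n → ℤ → Vector ℤ n → Vector ℤ n
ε-dual s l h y j with j ≟ s
... | yes _ = y j ℤ.+ h ℤ.* y l
... | no  _ = y j

IntegralModFirstRow : ∀ {p n} → Matrix (suc p) n → Set
IntegralModFirstRow N =
  (∀ j → IsIntegral (N zero j)) × (∀ i → ∃ λ r → ∀ j → IsIntegral (N (suc i) j - r * N zero j))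

integer-integralModFirstRow : ∀ {p n} (M : Fin (suc p) → Fin n → ℤ) → IntegralModFirstRow (toℚ M)
integer-integralModFirstRow M = (λ j → M zero j , refl) , (λ i → 0ℚ , λ j → M (suc i) j , residue i j)
  where
  residue : ∀ i j → toℚ M (suc i) j - 0ℚ * toℚ M zero j ≡ toℚ M (suc i) j
  residue i j = solve 2 (λ x a → x :- con 0ℚ :* a := x) refl (toℚ M (suc i) j) (toℚ M zero j)

ε-residue : ∀ X r a h Y b → (X - r * a) + h * (Y - r * b) ≡ (X + h * Y) - r * (a + h * b)
ε-residue = solve 6 (λ X r a h Y b → (X :- r :* a) :+ h :* (Y :- r :* b)
                                     := (X :+ h :* Y) :- r :* (a :+ h :* b)) refl

γ-pivot-residue : ∀ μ ι X r a Y W → ι * μ ≡ 1ℚ → a * Y + μ * W ≡ 1ℚ →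
                  ι * X - ι * (r + (X - r * a) * Y) * a ≡ (X - r * a) * W
γ-pivot-residue μ ι X r a Y W ιμ≡1 bezout = begin
  ι * X - ι * (r + (X - r * a) * Y) * a
    ≡⟨ solve 5 (λ ι X r a Y → ι :* X :- ι :* (r :+ (X :- r :* a) :* Y) :* a
                              := ι :* (X :- r :* a) :* (con 1ℚ :- a :* Y)) refl ι X r a Y ⟩
  ι * (X - r * a) * (1ℚ - a * Y)
    ≡⟨ cong (λ t → ι * (X - r * a) * (t - a * Y)) (sym bezout) ⟩
  ι * (X - r * a) * (a * Y + μ * W - a * Y)
    ≡⟨ solve 7 (λ ι X r a Y μ W → ι :* (X :- r :* a) :* (a :* Y :+ μ :* W :- a :* Y)
                                  := ι :* μ :* ((X :- r :* a) :* W)) refl ι X r a Y μ W ⟩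
  ι * μ * ((X - r * a) * W)
    ≡⟨ cong (_* ((X - r * a) * W)) ιμ≡1 ⟩
  1ℚ * ((X - r * a) * W)
    ≡⟨ *-identityˡ ((X - r * a) * W) ⟩
  (X - r * a) * W
    ∎
  where open ≡-Reasoning

γ-offPivot-residue : ∀ μ ι X r a ζ → ι * μ ≡ 1ℚ → X - ι * (r + ζ) * (μ * a) ≡ (X - r * a) - ζ * a
γ-offPivot-residue μ ι X r a ζ ιμ≡1 = begin
  X - ι * (r + ζ) * (μ * a)
    ≡⟨ solve 6 (λ X ι r ζ μ a → X :- ι :* (r :+ ζ) :* (μ :* a)
                                := X :- ι :* μ :* ((r :+ ζ) :* a)) refl X ι r ζ μ a ⟩
  X - ι * μ * ((r + ζ) * a)
    ≡⟨ cong (λ t → X - t * ((r + ζ) * a)) ιμ≡1 ⟩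
  X - 1ℚ * ((r + ζ) * a)
    ≡⟨ solve 4 (λ X r ζ a → X :- con 1ℚ :* ((r :+ ζ) :* a)
                            := (X :- r :* a) :- ζ :* a) refl X r ζ a ⟩
  (X - r * a) - ζ * a
    ∎
  where open ≡-Reasoning

module _ {p n : ℕ} where

  γ-·-dual : ∀ s m m≢0 (N : Matrix (suc p) n) y →
             apply (γ s m m≢0) N zero · y ≡ N zero · γ-dual s m y
  γ-·-dual s m m≢0 N y = sum-cong-≗ entry
    where
    entry : ∀ j → apply (γ s m m≢0) N zero j * ℤ→ℚ (y j) ≡ N zero j * ℤ→ℚ (γ-dual s m y j)
    entry j with j ≟ s
    ... | yes _ = refl
    ... | no  _ = trans (solve 3 (λ μ a Y → μ :* a :* Y := a :* (μ :* Y)) refl (ℤ→ℚ m) (N zero j) (ℤ→ℚ (y j)))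
                        (cong (N zero j *_) (sym (ℤ→ℚ-homo-* m (y j))))

  ε-·-dual : ∀ s l h l≢s (N : Matrix (suc p) n) y →
             apply (ε s l h l≢s) N zero · y ≡ N zero · ε-dual s l h y
  ε-·-dual s l h l≢s N y = begin
    apply (ε s l h l≢s) N zero · y     ≡⟨ sum-cong-≗ transformed ⟩
    sum (λ j → a j * Y j + δ l c j)    ≡⟨ sum-+-δ (λ j → a j * Y j) l c ⟩
    a · y + c                          ≡⟨ sym (sum-+-δ (λ j → a j * Y j) s c) ⟩
    sum (λ j → a j * Y j + δ s c j)    ≡⟨ sym (sum-cong-≗ dual) ⟩
    a · ε-dual s l h y                 ∎
    where
    open ≡-Reasoning
    a = N zero
    Y = λ j → ℤ→ℚ (y j)
    c = ℤ→ℚ h * a s * Y l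
    transformed : ∀ j → apply (ε s l h l≢s) N zero j * Y j ≡ a j * Y j + δ l c j
    transformed j with j ≟ l
    ... | yes refl = trans (solve 4 (λ x H b Y → (x :+ H :* b) :* Y := x :* Y :+ H :* b :* Y)
                                    refl (a j) (ℤ→ℚ h) (a s) (Y j))
                           (cong (a j * Y j +_) (sym (δ-diag j c)))
    ... | no  j≢l  = trans (sym (+-identityʳ _)) (cong (a j * Y j +_) (sym (δ-offDiag l j c j≢l)))
    dual : ∀ j → a j * ℤ→ℚ (ε-dual s l h y j) ≡ a j * Y j + δ s c j
    dual j with j ≟ s
    ... | yes refl = begin
      a j * ℤ→ℚ (y j ℤ.+ h ℤ.* y l)    ≡⟨ cong (a j *_) (trans (ℤ→ℚ-homo-+ (y j) (h ℤ.* y l))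
                                                               (cong (Y j +_) (ℤ→ℚ-homo-* h (y l)))) ⟩
      a j * (Y j + ℤ→ℚ h * Y l)        ≡⟨ solve 4 (λ x H Y Z → x :* (Y :+ H :* Z) := x :* Y :+ H :* x :* Z)
                                                  refl (a j) (ℤ→ℚ h) (Y j) (Y l) ⟩
      a j * Y j + c                    ≡⟨ cong (a j * Y j +_) (sym (δ-diag j c)) ⟩
      a j * Y j + δ j c j              ∎
    ... | no  j≢s  = trans (sym (+-identityʳ _)) (cong (a j * Y j +_) (sym (δ-offDiag s j c j≢s)))

  apply-reflects-unimodular : ∀ ρ (N : Matrix (suc p) n) → Unimodular (apply ρ N zero) → Unimodular (N zero)
  apply-reflects-unimodular (γ s m m≢0)   N (y , a·y≡1) = γ-dual s m y , trans (sym (γ-·-dual s m m≢0 N y)) a·y≡1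
  apply-reflects-unimodular (ε s l h l≢s) N (y , a·y≡1) = ε-dual s l h y , trans (sym (ε-·-dual s l h l≢s N y)) a·y≡1

  applyAll-reflects-unimodular : ∀ ρs (N : Matrix (suc p) n) →
                                 Unimodular (applyAll ρs N zero) → Unimodular (N zero)
  applyAll-reflects-unimodular []       N u = u
  applyAll-reflects-unimodular (ρ ∷ ρs) N u =
    apply-reflects-unimodular ρ N (applyAll-reflects-unimodular ρs (apply ρ N) u)

  γ-bezout : ∀ s m m≢0 (N : Matrix (suc p) n) → (∀ j → IsIntegral (N zero j)) →
             Unimodular (apply (γ s m m≢0) N zero) →
             ∃₂ λ (Y : ℤ) (W : ℚ) → IsIntegral W × (N zero s * ℤ→ℚ Y + ℤ→ℚ m * W ≡ 1ℚ)
  γ-bezout s m m≢0 N a∈ℤ (y , a·y≡1) =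
    y s , sum offPivot , isIntegral-sum offPivot∈ℤ , trans (sym decomposition) a·y≡1
    where
    open ≡-Reasoning
    a = N zero
    Y = λ j → ℤ→ℚ (y j)
    μ = ℤ→ℚ m
    offPivot : Vector ℚ n
    offPivot j with j ≟ s
    ... | yes _ = 0ℚ
    ... | no  _ = a j * Y j
    offPivot∈ℤ : ∀ j → IsIntegral (offPivot j)
    offPivot∈ℤ j with j ≟ s
    ... | yes _ = 0ℤ , refl
    ... | no  _ = isIntegral-* (a∈ℤ j) (y j , refl)
    split : ∀ j → apply (γ s m m≢0) N zero j * Y j ≡ δ s (a s * Y s) j + μ * offPivot j
    split j with j ≟ s
    ... | yes refl = trans (sym (+-identityʳ _)) (cong₂ _+_ (sym (δ-diag j _)) (sym (*-zeroʳ μ)))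
    ... | no  j≢s  = trans (solve 3 (λ μ x Y → μ :* x :* Y := μ :* (x :* Y)) refl μ (a j) (Y j))
                           (trans (sym (+-identityˡ _)) (cong (_+ μ * (a j * Y j)) (sym (δ-offDiag s j _ j≢s))))
    decomposition : apply (γ s m m≢0) N zero · y ≡ a s * Y s + μ * sum offPivot
    decomposition = begin
      apply (γ s m m≢0) N zero · y
        ≡⟨ sum-cong-≗ split ⟩
      sum (λ j → δ s (a s * Y s) j + μ * offPivot j)
        ≡⟨ ∑-distrib-+ (δ s (a s * Y s)) (λ j → μ * offPivot j) ⟩
      sum (δ s (a s * Y s)) + sum (λ j → μ * offPivot j)
        ≡⟨ cong₂ _+_ (sum-δ s (a s * Y s)) (sym (*-distribˡ-sum μ offPivot)) ⟩
      a s * Y s + μ * sum offPivot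
        ∎

  ε-preserves-integralModFirstRow : ∀ s l h l≢s (N : Matrix (suc p) n) → IntegralModFirstRow N →
                                    IntegralModFirstRow (apply (ε s l h l≢s) N)
  ε-preserves-integralModFirstRow s l h l≢s N (a∈ℤ , rows) = first , lower
    where
    N′ = apply (ε s l h l≢s) N
    first : ∀ j → IsIntegral (N′ zero j)
    first j with j ≟ l
    ... | yes _ = isIntegral-+ (a∈ℤ l) (isIntegral-* (h , refl) (a∈ℤ s))
    ... | no  _ = a∈ℤ j
    lower : ∀ i → ∃ λ r → ∀ j → IsIntegral (N′ (suc i) j - r * N′ zero j)
    lower i with rows i
    ... | r , X-ra∈ℤ = r , residue
      where
      residue : ∀ j → IsIntegral (N′ (suc i) j - r * N′ zero j)
      residue j with j ≟ l
      ... | yes _ = subst IsIntegral (ε-residue (N (suc i) l) r (N zero l) (ℤ→ℚ h) (N (suc i) s) (N zero s))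
                          (isIntegral-+ (X-ra∈ℤ l) (isIntegral-* (h , refl) (X-ra∈ℤ s)))
      ... | no  _ = X-ra∈ℤ j

  γ-preserves-integralModFirstRow : ∀ s m m≢0 (N : Matrix (suc p) n) → IntegralModFirstRow N →
                                    ∀ Y W → IsIntegral W → N zero s * ℤ→ℚ Y + ℤ→ℚ m * W ≡ 1ℚ →
                                    IntegralModFirstRow (apply (γ s m m≢0) N)
  γ-preserves-integralModFirstRow s m m≢0 N (a∈ℤ , rows) Y W W∈ℤ bezout = first , lower
    where
    N′ = apply (γ s m m≢0) N
    a = N zero
    ι = inv m m≢0
    first : ∀ j → IsIntegral (N′ zero j)
    first j with j ≟ s
    ... | yes _ = a∈ℤ j
    ... | no  _ = isIntegral-* (m , refl) (a∈ℤ j)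
    lower : ∀ i → ∃ λ r → ∀ j → IsIntegral (N′ (suc i) j - r * N′ zero j)
    lower i with rows i
    ... | r , X-ra∈ℤ = ι * (r + z * ℤ→ℚ Y) , residue
      where
      X = N (suc i)
      z = X s - r * a s
      residue : ∀ j → IsIntegral (N′ (suc i) j - ι * (r + z * ℤ→ℚ Y) * N′ zero j)
      residue j with j ≟ s
      ... | yes refl = subst IsIntegral (sym (γ-pivot-residue (ℤ→ℚ m) ι (X j) r (a j) (ℤ→ℚ Y) W
                                                               (inv-inverseˡ m m≢0) bezout))
                             (isIntegral-* (X-ra∈ℤ j) W∈ℤ)
      ... | no  _    = subst IsIntegral (sym (γ-offPivot-residue (ℤ→ℚ m) ι (X j) r (a j) (z * ℤ→ℚ Y)
                                                                  (inv-inverseˡ m m≢0)))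
                             (isIntegral-difference (X-ra∈ℤ j)
                                (isIntegral-* (isIntegral-* (X-ra∈ℤ s) (Y , refl)) (a∈ℤ j)))

  apply-preserves-integralModFirstRow : ∀ ρ (N : Matrix (suc p) n) → IntegralModFirstRow N →
                                        Unimodular (apply ρ N zero) → IntegralModFirstRow (apply ρ N)
  apply-preserves-integralModFirstRow (γ s m m≢0) N intMod u with γ-bezout s m m≢0 N (proj₁ intMod) u
  ... | Y , W , W∈ℤ , bezout = γ-preserves-integralModFirstRow s m m≢0 N intMod Y W W∈ℤ bezout
  apply-preserves-integralModFirstRow (ε s l h l≢s) N intMod _ = ε-preserves-integralModFirstRow s l h l≢s N intMod

  applyAll-preserves-integralModFirstRow : ∀ ρs (N : Matrix (suc p) n) → IntegralModFirstRow N →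
                                           Unimodular (applyAll ρs N zero) → IntegralModFirstRow (applyAll ρs N)
  applyAll-preserves-integralModFirstRow []       N intMod u = intMod
  applyAll-preserves-integralModFirstRow (ρ ∷ ρs) N intMod u =
    applyAll-preserves-integralModFirstRow ρs (apply ρ N)
      (apply-preserves-integralModFirstRow ρ N intMod (applyAll-reflects-unimodular ρs (apply ρ N) u)) u

-- The gcd hypothesis is unused: the normal form already forces the first row of M to be
-- unimodular (applyAll-reflects-unimodular).
corollary11 : (p q : ℕ) (M : Fin (suc p) → Fin (suc q) → ℤ)
    → gcdRow (M zero) ≡ 1
    → (ρs : List (Transformation (suc q)))
    → applyAll ρs (toℚ M) zero zero ≡ 1ℚ
    → (∀ (j : Fin q) → applyAll ρs (toℚ M) zero (suc j) ≡ 0ℚ)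
    → ∀ (i : Fin p) (j : Fin q) → ∃ λ (z : ℤ) → applyAll ρs (toℚ M) (suc i) (suc j) ≡ ℤ→ℚ z
corollary11 p q M _ ρs N₀₀≡1 N₀₊≡0 i j = entry-integral (proj₂ final i)
  where
  N = applyAll ρs (toℚ M)
  final : IntegralModFirstRow N
  final = applyAll-preserves-integralModFirstRow ρs (toℚ M) (integer-integralModFirstRow M)
            (firstUnit-unimodular (N zero) N₀₀≡1 N₀₊≡0)
  residue≡entry : ∀ r → N (suc i) (suc j) - r * N zero (suc j) ≡ N (suc i) (suc j)
  residue≡entry r = trans (cong (λ t → N (suc i) (suc j) - r * t) (N₀₊≡0 j))
                          (solve 2 (λ x r → x :- r :* con 0ℚ := x) refl (N (suc i) (suc j)) r)
  entry-integral : (∃ λ r → ∀ j → IsIntegral (N (suc i) j - r * N zero j)) → IsIntegral (N (suc i) (suc j))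
  entry-integral (r , residue∈ℤ) = subst IsIntegral (residue≡entry r) (residue∈ℤ (suc j))
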